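{- Let $P$, $Q$, $R$ be Interface Automata with common input alphabet $I$ and common output alphabet $O$, where $P$ and $Q$ have disjoint state sets, and let $p\in P$, $q\in Q$, $r\in R$. Then $p\vee q\sqsubseteq_{\mathrm{IA}} r$ if and only if $p\sqsubseteq_{\mathrm{IA}} r$ and $q\sqsubseteq_{\mathrm{IA}} r$, where $p\vee q$ is the corresponding state of the IA-disjunction $P\vee Q$.
   Context: An Interface Automaton (IA) is a tuple $P=(P,I,O,\rightarrow_P)$ where $P$ is a set of states, $I$ and $O$ are disjoint sets of input and output actions not containing the special silent action $\tau$, and $\rightarrow_P\subseteq P\times(I\cup O\cup\{\tau\})\times P$ is input-deterministic: for $a\in I$, $p\xrightarrow{a}p'$ and $p\xrightarrow{a}p''$ imply $p'=p''$. Weak transitions: $p\stackrel{\epsilon}{\Rightarrow}p'$ iff $p(\xrightarrow{\tau})^*p'$; for $o\in O$, $p\stackrel{o}{\Rightarrow}p'$ iff there is $p''$ with $p\stackrel{\epsilon}{\Rightarrow}p''\xrightarrow{o}p'$; $\hat\alpha=\epsilon$ if $\alpha=\tau$ and $\hat\alpha=\alpha$ otherwise. For IAs $P,Q$ with the same alphabets, $\mathcal R\subseteq P\times Q$ is an alternating simulation if for all $(p,q)\in\mathcal R$: (i) $q\xrightarrow{a}q'$ with $a\in I$ implies some $p'$ with $p\xrightarrow{a}p'$ and $(p',q')\in\mathcal R$; (ii) $p\xrightarrow{\alpha}p'$ with $\alpha\in O\cup\{\tau\}$ implies some $q'$ with $q\stackrel{\hat\alpha}{\Rightarrow}q'$ and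 $(p',q')\in\mathcal R$. Write $p\sqsubseteq_{\mathrm{IA}}q$ if some alternating simulation contains $(p,q)$. IA-disjunction: for IAs $P=(P,I,O,\rightarrow_P)$, $Q=(Q,I,O,\rightarrow_Q)$ with disjoint state sets, $P\vee Q$ is the IA with state set $\{p\vee q: p\in P,q\in Q\}\cup P\cup Q$, alphabets $I,O$, and the least transition relation containing $\rightarrow_P$ and $\rightarrow_Q$ and satisfying: (I) $p\vee q\xrightarrow{a}p'\vee q'$ if $p\xrightarrow{a}_Pp'$, $q\xrightarrow{a}_Qq'$ and $a\in I$; (OT1) $p\vee q\xrightarrow{\alpha}p'$ if $p\xrightarrow{\alpha}_Pp'$ and $\alpha\in O\cup\{\tau\}$; (OT2) $p\vee q\xrightarrow{\alpha}q'$ if $q\xrightarrow{\alpha}_Qq'$ and $\alpha\in O\cup\{\tau\}$. -}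

module Defs where

open import Level using (Level; _⊔_; suc; Lift)
open import Relation.Binary.PropositionalEquality using (_≡_)
open import Relation.Binary.Construct.Closure.ReflexiveTransitive using (Star)
open import Data.Product using (Σ; ∃; _×_; _,_)

-- Actions over input alphabet I and output alphabet O, plus the silent τ.
-- I and O are disjoint by construction (tagged union), and τ is in neither.
data Act {ℓ : Level} (I O : Set ℓ) : Set ℓ where
  inp : I → Act I O
  out : O → Act I O
  τ   : Act I O

record IA {ℓ : Level} (I O : Set ℓ) : Set (suc ℓ) where
  field
    State : Set ℓ
    Step  : State → Act I O → State → Set ℓ
    input-det : ∀ {p p′ p″} (i : I) → Step p (inp i) p′ → Step p (inp i) p″ → p′ ≡ p″

open IA public

module _ {ℓ : Level} {I O : Set ℓ} (P : IA I O) where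
  WeakEps : State P → State P → Set ℓ
  WeakEps = Star (λ x y → Step P x τ y)

  -- p =α̂=> p' for α ∈ O ∪ {τ}:  ε-move if α = τ;  p =ε=> p'' -o-> p' if α = o ∈ O.
  -- (never used for inputs; the input clause is a strong transition.)
  WeakHat : State P → Act I O → State P → Set ℓ
  WeakHat p (inp i) p′ = (Step P p (inp i) p′)
  WeakHat p (out o) p′ = (∃ λ p″ → WeakEps p p″ × Step P p″ (out o) p′)
  WeakHat p τ p′       = (WeakEps p p′)

data OutOrτ {ℓ : Level} {I O : Set ℓ} : Act I O → Set ℓ where
  isOut : (o : O) → OutOrτ (out o)
  isτ   : OutOrτ τ

IsAltSim : ∀ {ℓ r : Level} {I O : Set ℓ} (P Q : IA I O)
         → (State P → State Q → Set r) → Set (ℓ ⊔ r)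
IsAltSim {I = I} P Q ℛ = ∀ {p q} → ℛ p q →
     (∀ (i : I) q′ → Step Q q (inp i) q′ → ∃ λ p′ → Step P p (inp i) p′ × ℛ p′ q′)
   × (∀ α p′ → OutOrτ α → Step P p α p′ → ∃ λ q′ → WeakHat Q q α q′ × ℛ p′ q′)

Refines : ∀ {ℓ : Level} {I O : Set ℓ} (P Q : IA I O)
        → State P → State Q → Set (suc ℓ)
Refines {ℓ} P Q p q =
  ∃ λ (ℛ : State P → State Q → Set ℓ) → IsAltSim P Q ℛ × ℛ p q

-- States of P ∨ Q: {p ∨ q} ∪ P ∪ Q, as a disjoint union (P, Q have disjoint state sets).
data JState {s : Level} (A B : Set s) : Set s where
  _∨ₛ_ : A → B → JState A B
  inl  : A → JState A B
  inr  : B → JState A B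

module _ {ℓ : Level} {I O : Set ℓ} (P Q : IA I O) where
  data JStep : JState (State P) (State Q) → Act I O → JState (State P) (State Q) → Set ℓ where
    stepP : ∀ {p α p′} → Step P p α p′ → JStep (inl p) α (inl p′)
    stepQ : ∀ {q α q′} → Step Q q α q′ → JStep (inr q) α (inr q′)
    ruleI : ∀ {p q p′ q′} (i : I) → Step P p (inp i) p′ → Step Q q (inp i) q′
          → JStep (p ∨ₛ q) (inp i) (p′ ∨ₛ q′)
    ruleOT1 : ∀ {p q α p′} → OutOrτ α → Step P p α p′ → JStep (p ∨ₛ q) α (inl p′)
    ruleOT2 : ∀ {p q α q′} → OutOrτ α → Step Q q α q′ → JStep (p ∨ₛ q) α (inr q′)

  open import Relation.Binary.PropositionalEquality using (cong; cong₂)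

  JStep-det : ∀ {x y z} (i : I) → JStep x (inp i) y → JStep x (inp i) z → y ≡ z
  JStep-det i (stepP s₁) (stepP s₂) = cong inl (input-det P i s₁ s₂)
  JStep-det i (stepQ s₁) (stepQ s₂) = cong inr (input-det Q i s₁ s₂)
  JStep-det i (ruleI .i a₁ b₁) (ruleI .i a₂ b₂) =
    cong₂ _∨ₛ_ (input-det P i a₁ a₂) (input-det Q i b₁ b₂)
  JStep-det i (ruleI _ _ _) (ruleOT1 () _)
  JStep-det i (ruleI _ _ _) (ruleOT2 () _)
  JStep-det i (ruleOT1 () _) _
  JStep-det i (ruleOT2 () _) _

  _∨IA_ : IA I O
  _∨IA_ = record { State = JState (State P) (State Q) ; Step = JStep ; input-det = JStep-det }

-- Refinement is transitive, and p ∨ q is refined by both p and q (its first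
-- output or τ step commits to one disjunct, its inputs are those the two
-- disjuncts share). Hence p ∨ q ⊑ r gives p ⊑ r and q ⊑ r. Conversely, two
-- alternating simulations for p and q combine into one for p ∨ q by relating
-- p′ ∨ q′ to r′ when both components are related to r′.
module Submission where

open import Defs
open import Level using (Level)
open import Data.Product using (_×_; _,_; ∃; proj₁; proj₂; map; map₁)
open import Function.Bundles using (_⇔_; mk⇔)
open import Relation.Binary.Construct.Closure.ReflexiveTransitive using (ε; _◅_; _◅◅_)

Step-WeakHat : ∀ {ℓ} {I O : Set ℓ} (P : IA I O) {α p p′}
             → OutOrτ α → Step P p α p′ → WeakHat P p α p′
Step-WeakHat P isτ       p→p′ = p→p′ ◅ ε
Step-WeakHat P (isOut o) p→p′ = _ , ε , p→p′

module _ {ℓ : Level} {I O : Set ℓ} {Q R : IA I O} {ℛ : State Q → State R → Set ℓ}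
         (sim : IsAltSim Q R ℛ) where

  IsAltSim-WeakEps : ∀ {q q′ r} → ℛ q r → WeakEps Q q q′
                   → ∃ λ r′ → WeakEps R r r′ × ℛ q′ r′
  IsAltSim-WeakEps qℛr ε        = _ , ε , qℛr
  IsAltSim-WeakEps qℛr (t ◅ ts) =
    let r₁ , r⇒r₁ , q₁ℛr₁  = proj₂ (sim qℛr) τ _ isτ t
        r′ , r₁⇒r′ , q′ℛr′ = IsAltSim-WeakEps q₁ℛr₁ ts
    in r′ , r⇒r₁ ◅◅ r₁⇒r′ , q′ℛr′

  IsAltSim-WeakHat : ∀ {α q q′ r} → OutOrτ α → ℛ q r → WeakHat Q q α q′
                   → ∃ λ r′ → WeakHat R r α r′ × ℛ q′ r′
  IsAltSim-WeakHat isτ       qℛr q⇒q′                 = IsAltSim-WeakEps qℛr q⇒q′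
  IsAltSim-WeakHat (isOut o) qℛr (_ , q⇒q₁ , q₁→q′) =
    let r₁ , r⇒r₁ , q₁ℛr₁                  = IsAltSim-WeakEps qℛr q⇒q₁
        r′ , (r₂ , r₁⇒r₂ , r₂→r′) , q′ℛr′ = proj₂ (sim q₁ℛr₁) (out o) _ (isOut o) q₁→q′
    in r′ , (r₂ , r⇒r₁ ◅◅ r₁⇒r₂ , r₂→r′) , q′ℛr′

module _ {ℓ : Level} {I O : Set ℓ} {P Q R : IA I O}
         {ℛ₁ : State P → State Q → Set ℓ} {ℛ₂ : State Q → State R → Set ℓ}
         (sim₁ : IsAltSim P Q ℛ₁) (sim₂ : IsAltSim Q R ℛ₂) where

  IsAltSim-compose : IsAltSim P R (λ p r → ∃ λ q → ℛ₁ p q × ℛ₂ q r)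
  IsAltSim-compose (q , pℛ₁q , qℛ₂r) =
    (λ i r′ r→r′ →
       let q′ , q→q′ , q′ℛ₂r′ = proj₁ (sim₂ qℛ₂r) i r′ r→r′
           p′ , p→p′ , p′ℛ₁q′ = proj₁ (sim₁ pℛ₁q) i q′ q→q′
       in p′ , p→p′ , q′ , p′ℛ₁q′ , q′ℛ₂r′)
    , λ α p′ α-out p→p′ →
       let q′ , q⇒q′ , p′ℛ₁q′ = proj₂ (sim₁ pℛ₁q) α p′ α-out p→p′
           r′ , r⇒r′ , q′ℛ₂r′ = IsAltSim-WeakHat sim₂ α-out qℛ₂r q⇒q′
       in r′ , r⇒r′ , q′ , p′ℛ₁q′ , q′ℛ₂r′

module _ {ℓ : Level} {I O : Set ℓ} {P Q R : IA I O} where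

  Refines-trans : ∀ {p q r} → Refines P Q p q → Refines Q R q r → Refines P R p r
  Refines-trans (ℛ₁ , sim₁ , pℛ₁q) (ℛ₂ , sim₂ , qℛ₂r) =
    _ , IsAltSim-compose {P = P} {Q = Q} {R = R} sim₁ sim₂ , _ , pℛ₁q , qℛ₂r

module _ {ℓ : Level} {I O : Set ℓ} (P Q : IA I O) where

  data LeftOf : State P → JState (State P) (State Q) → Set ℓ where
    leftOf-inl : ∀ {p} → LeftOf p (inl p)
    leftOf-∨   : ∀ {p q} → LeftOf p (p ∨ₛ q)

  data RightOf : State Q → JState (State P) (State Q) → Set ℓ where
    rightOf-inr : ∀ {q} → RightOf q (inr q)
    rightOf-∨   : ∀ {p q} → RightOf q (p ∨ₛ q)

  IsAltSim-LeftOf : IsAltSim P (P ∨IA Q) LeftOf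
  IsAltSim-LeftOf leftOf-inl =
    (λ { i (inl p′) (stepP p→p′) → p′ , p→p′ , leftOf-inl })
    , λ α p′ α-out p→p′ → inl p′ , Step-WeakHat (P ∨IA Q) α-out (stepP p→p′) , leftOf-inl
  IsAltSim-LeftOf leftOf-∨ =
    (λ { i (p′ ∨ₛ q′) (ruleI _ p→p′ _) → p′ , p→p′ , leftOf-∨
       ; i _ (ruleOT1 () _)
       ; i _ (ruleOT2 () _) })
    , λ α p′ α-out p→p′ → inl p′ , Step-WeakHat (P ∨IA Q) α-out (ruleOT1 α-out p→p′) , leftOf-inl

  IsAltSim-RightOf : IsAltSim Q (P ∨IA Q) RightOf
  IsAltSim-RightOf rightOf-inr =
    (λ { i (inr q′) (stepQ q→q′) → q′ , q→q′ , rightOf-inr })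
    , λ α q′ α-out q→q′ → inr q′ , Step-WeakHat (P ∨IA Q) α-out (stepQ q→q′) , rightOf-inr
  IsAltSim-RightOf rightOf-∨ =
    (λ { i (p′ ∨ₛ q′) (ruleI _ _ q→q′) → q′ , q→q′ , rightOf-∨
       ; i _ (ruleOT1 () _)
       ; i _ (ruleOT2 () _) })
    , λ α q′ α-out q→q′ → inr q′ , Step-WeakHat (P ∨IA Q) α-out (ruleOT2 α-out q→q′) , rightOf-inr

  Refines-∨ˡ : ∀ p q → Refines P (P ∨IA Q) p (p ∨ₛ q)
  Refines-∨ˡ p q = LeftOf , IsAltSim-LeftOf , leftOf-∨

  Refines-∨ʳ : ∀ p q → Refines Q (P ∨IA Q) q (p ∨ₛ q)
  Refines-∨ʳ p q = RightOf , IsAltSim-RightOf , rightOf-∨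

module _ {ℓ : Level} {I O : Set ℓ} {P Q R : IA I O} where

  _∨ᴿ_ : (State P → State R → Set ℓ) → (State Q → State R → Set ℓ)
       → JState (State P) (State Q) → State R → Set ℓ
  (ℛ₁ ∨ᴿ ℛ₂) (p ∨ₛ q) r = ℛ₁ p r × ℛ₂ q r
  (ℛ₁ ∨ᴿ ℛ₂) (inl p)  r = ℛ₁ p r
  (ℛ₁ ∨ᴿ ℛ₂) (inr q)  r = ℛ₂ q r

  IsAltSim-∨ : ∀ {ℛ₁ ℛ₂} → IsAltSim P R ℛ₁ → IsAltSim Q R ℛ₂ → IsAltSim (P ∨IA Q) R (ℛ₁ ∨ᴿ ℛ₂)
  IsAltSim-∨ sim₁ sim₂ {inl p} pℛr =
    (λ i r′ r→r′ → map inl (map₁ stepP) (proj₁ (sim₁ pℛr) i r′ r→r′))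
    , λ { α (inl p′) α-out (stepP p→p′) → proj₂ (sim₁ pℛr) α p′ α-out p→p′ }
  IsAltSim-∨ sim₁ sim₂ {inr q} qℛr =
    (λ i r′ r→r′ → map inr (map₁ stepQ) (proj₁ (sim₂ qℛr) i r′ r→r′))
    , λ { α (inr q′) α-out (stepQ q→q′) → proj₂ (sim₂ qℛr) α q′ α-out q→q′ }
  IsAltSim-∨ sim₁ sim₂ {p ∨ₛ q} (pℛr , qℛr) =
    (λ i r′ r→r′ →
       let p′ , p→p′ , p′ℛr′ = proj₁ (sim₁ pℛr) i r′ r→r′
           q′ , q→q′ , q′ℛr′ = proj₁ (sim₂ qℛr) i r′ r→r′
       in p′ ∨ₛ q′ , ruleI i p→p′ q→q′ , p′ℛr′ , q′ℛr′)
    , λ { α (inl p′) α-out (ruleOT1 _ p→p′) → proj₂ (sim₁ pℛr) α p′ α-out p→p′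
        ; α (inr q′) α-out (ruleOT2 _ q→q′) → proj₂ (sim₂ qℛr) α q′ α-out q→q′ }

  Refines-∨-lub : ∀ {p q r} → Refines P R p r → Refines Q R q r → Refines (P ∨IA Q) R (p ∨ₛ q) r
  Refines-∨-lub (ℛ₁ , sim₁ , pℛ₁r) (ℛ₂ , sim₂ , qℛ₂r) =
    ℛ₁ ∨ᴿ ℛ₂ , IsAltSim-∨ sim₁ sim₂ , pℛ₁r , qℛ₂r

theorem2p7 : ∀ {ℓ : Level} {I O : Set ℓ} (P Q R : IA I O)
    (p : State P) (q : State Q) (r : State R)
    → Refines (P ∨IA Q) R (p ∨ₛ q) r ⇔ (Refines P R p r × Refines Q R q r)
theorem2p7 P Q R p q r = mk⇔
  (λ p∨q⊑r → Refines-trans {P = P} {Q = P ∨IA Q} (Refines-∨ˡ P Q p q) p∨q⊑r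
           , Refines-trans {P = Q} {Q = P ∨IA Q} (Refines-∨ʳ P Q p q) p∨q⊑r)
  (λ (p⊑r , q⊑r) → Refines-∨-lub p⊑r q⊑r)
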